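{- Let $M$ be a matroid, let $SP$ be the set of spanning sets of $M$, and for $X\in SP$ let $NI(X)$ be the number of independent sets of $M$ contained in $X$. Then $$T^2_M(2,1;1,2)=\sum_{X\in SP}NI(X).$$
   Context: For a matroid $M$ on ground set $\mathcal{A}$ with rank function $\mathrm{rk}$, $T^2_M(x_1,x_2;y_1,y_2)=\sum_{S_1\subseteq S_2\subseteq\mathcal{A}}\prod_{i=1}^2(x_i-1)^{\mathrm{rk}(\mathcal{A})-\mathrm{rk}(S_i)}(y_i-1)^{|S_i|-\mathrm{rk}(S_i)}$, regarded as a polynomial. A set $X$ is spanning if $\mathrm{rk}(X)=\mathrm{rk}(\mathcal{A})$. -}

module Defs where

open import Data.Nat as ℕ using (ℕ; zero; suc; _≤_)
open import Data.Integer as ℤ using (ℤ; +_; _-_)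
open import Data.Bool using (Bool; true; false)
open import Data.Vec using (Vec; []; _∷_)
open import Data.List as List using (List; []; _∷_; map; _++_; concatMap)
open import Data.Fin.Subset using (Subset; _⊆_; _∪_; _∩_; ∣_∣; ⊤)
open import Data.Fin.Subset.Properties using (_⊆?_)
open import Relation.Binary.PropositionalEquality using (_≡_)
open import Relation.Nullary using (does)
open import Data.Nat.ListAction using () renaming (sum to sumℕ)

-- A matroid on the ground set Fin n, given by its rank function
-- (rank axioms R1–R3 of Oxley).
record Matroid (n : ℕ) : Set where
  field
    rk        : Subset n → ℕ
    rk-bound  : ∀ X → rk X ≤ ∣ X ∣
    rk-mono   : ∀ X Y → X ⊆ Y → rk X ≤ rk Y
    rk-submod : ∀ X Y → rk (X ∪ Y) ℕ.+ rk (X ∩ Y) ≤ rk X ℕ.+ rk Y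

open Matroid public

allSubsets : (n : ℕ) → List (Subset n)
allSubsets zero    = [] ∷ []
allSubsets (suc n) = map (false ∷_) (allSubsets n) ++ map (true ∷_) (allSubsets n)

sumℤ : List ℤ → ℤ
sumℤ = List.foldr ℤ._+_ (+ 0)

Independent : ∀ {n} → Matroid n → Subset n → Set
Independent M X = rk M X ≡ ∣ X ∣

Spanning : ∀ {n} → Matroid n → Subset n → Set
Spanning M X = rk M X ≡ rk M ⊤

-- T^2_M evaluated at integers (x₁,x₂;y₁,y₂); ℤ._^_ has 0^0 = 1,
-- matching evaluation of the polynomial.
T2 : ∀ {n} → Matroid n → ℤ → ℤ → ℤ → ℤ → ℤ
T2 {n} M x₁ x₂ y₁ y₂ =
  sumℤ (concatMap (λ S₂ → concatMap (λ S₁ →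
      if? S₁ S₂) (allSubsets n)) (allSubsets n))
  where
    r : ℕ
    r = rk M ⊤
    term : ℤ → ℤ → Subset n → ℤ
    term x y S = ((x - + 1) ℤ.^ (r ℕ.∸ rk M S)) ℤ.* ((y - + 1) ℤ.^ (∣ S ∣ ℕ.∸ rk M S))
    if? : Subset n → Subset n → List ℤ
    if? S₁ S₂ with does (S₁ ⊆? S₂)
    ... | true  = (term x₁ y₁ S₁ ℤ.* term x₂ y₂ S₂) ∷ []
    ... | false = []

NI : ∀ {n} → Matroid n → Subset n → ℕ
NI {n} M X = List.length (List.filter (λ Y → does? Y) (allSubsets n))
  where
    open import Relation.Nullary.Decidable using (_×-dec_)
    import Relation.Nullary
    import Data.Product
    does? : (Y : Subset n) → Relation.Nullary.Dec (Y ⊆ X Data.Product.× Independent M Y)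
    does? Y = (Y ⊆? X) ×-dec (rk M Y ℕ.≟ ∣ Y ∣)

sumNISpanning : ∀ {n} → Matroid n → ℕ
sumNISpanning {n} M =
  sumℕ (map (NI M) (List.filter (λ X → spanning? X) (allSubsets n)))
  where
    spanning? : (X : Subset n) → Relation.Nullary.Dec (Spanning M X)
    spanning? X = rk M X ℕ.≟ rk M ⊤
    import Relation.Nullary

{-# OPTIONS --safe #-}
-- At (x₁,x₂;y₁,y₂) = (2,1;1,2) each factor of T²_M is a power of 1 or of 0, and 0^k
-- with k = |S| − rk S ≥ 0 (resp. k = rk 𝒜 − rk S ≥ 0) is the indicator of S being
-- independent (resp. spanning). So T²_M(2,1;1,2) counts the pairs S₁ ⊆ S₂ with S₁
-- independent and S₂ spanning, which is Σ_{X ∈ SP} NI(X) grouped by S₂ = X.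
module Submission where

open import Defs
open import Data.Nat using (ℕ)
open import Data.Integer using (+_)
open import Relation.Binary.PropositionalEquality using (_≡_)

open import Data.Bool using (Bool; true; false; _∧_)
open import Data.Fin.Subset using (Subset; ∣_∣; ⊤)
open import Data.Fin.Subset.Properties using (_⊆?_; ⊆-max)
open import Data.Integer as ℤ using (ℤ; _-_; _^_)
import Data.Integer.Properties as ℤ
open import Data.List using (List; []; _∷_; _++_; map; concatMap; filter; length)
open import Data.List.Properties using (map-cong)
open import Data.Nat as ℕ using (suc; _∸_; _≤_; _≟_)
import Data.Nat.Properties as ℕ
open import Data.Nat.ListAction using () renaming (sum to sumℕ)
open import Data.Product using (Σ; _,_; proj₁; proj₂)
open import Function using (_∘_)
open import Relation.Nullary using (Dec; does; yes; no)
open import Relation.Unary using (Pred; Decidable)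
open import Relation.Binary.PropositionalEquality using (refl; cong; cong₂; sym; trans; module ≡-Reasoning)

𝟙 : Bool → ℕ
𝟙 true  = 1
𝟙 false = 0

𝟙-∧ : ∀ a b → 𝟙 (a ∧ b) ≡ 𝟙 a ℕ.* 𝟙 b
𝟙-∧ true  b = sym (ℕ.+-identityʳ (𝟙 b))
𝟙-∧ false b = refl

0^[m∸n]≡𝟙[n≟m] : ∀ {n m} → n ≤ m → (+ 0) ^ (m ∸ n) ≡ + 𝟙 (does (n ≟ m))
0^[m∸n]≡𝟙[n≟m] {n} {m} n≤m = via (n ≟ m)
  where
    via : (d : Dec (n ≡ m)) → (+ 0) ^ (m ∸ n) ≡ + 𝟙 (does d)
    via (yes refl) rewrite ℕ.n∸n≡0 n = refl
    via (no n≢m) with m ∸ n | ℕ.m<n⇒0<n∸m (ℕ.≤∧≢⇒< n≤m n≢m)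
    ... | suc _ | _ = refl

sumℤ-++ : (xs ys : List ℤ) → sumℤ (xs ++ ys) ≡ sumℤ xs ℤ.+ sumℤ ys
sumℤ-++ []       ys = sym (ℤ.+-identityˡ (sumℤ ys))
sumℤ-++ (x ∷ xs) ys = trans (cong (ℤ._+_ x) (sumℤ-++ xs ys)) (sym (ℤ.+-assoc x (sumℤ xs) (sumℤ ys)))

module _ {A : Set} where

  sumℤ-concatMap : (f : A → List ℤ) (xs : List A) →
    sumℤ (concatMap f xs) ≡ sumℤ (map (sumℤ ∘ f) xs)
  sumℤ-concatMap f []       = refl
  sumℤ-concatMap f (x ∷ xs) =
    trans (sumℤ-++ (f x) (concatMap f xs)) (cong (ℤ._+_ (sumℤ (f x))) (sumℤ-concatMap f xs))

  sumℤ-map-+ : (f : A → ℕ) (xs : List A) → sumℤ (map (+_ ∘ f) xs) ≡ + sumℕ (map f xs)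
  sumℤ-map-+ f []       = refl
  sumℤ-map-+ f (x ∷ xs) =
    trans (cong (ℤ._+_ (+ f x)) (sumℤ-map-+ f xs)) (sym (ℤ.pos-+ (f x) (sumℕ (map f xs))))

  sum-map-*ʳ : (f : A → ℕ) (c : ℕ) (xs : List A) →
    sumℕ (map (λ x → f x ℕ.* c) xs) ≡ sumℕ (map f xs) ℕ.* c
  sum-map-*ʳ f c []       = refl
  sum-map-*ʳ f c (x ∷ xs) =
    trans (cong (f x ℕ.* c ℕ.+_) (sum-map-*ʳ f c xs)) (sym (ℕ.*-distribʳ-+ c (f x) (sumℕ (map f xs))))

  module _ {p} {P : Pred A p} (P? : Decidable P) where

    length-filter≡sum-𝟙 : (xs : List A) → length (filter P? xs) ≡ sumℕ (map (𝟙 ∘ does ∘ P?) xs)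
    length-filter≡sum-𝟙 []       = refl
    length-filter≡sum-𝟙 (x ∷ xs) with does (P? x)
    ... | true  = cong suc (length-filter≡sum-𝟙 xs)
    ... | false = length-filter≡sum-𝟙 xs

    sum-filter≡sum-*𝟙 : (f : A → ℕ) (xs : List A) →
      sumℕ (map f (filter P? xs)) ≡ sumℕ (map (λ x → f x ℕ.* 𝟙 (does (P? x))) xs)
    sum-filter≡sum-*𝟙 f []       = refl
    sum-filter≡sum-*𝟙 f (x ∷ xs) with does (P? x)
    ... | true  = cong₂ ℕ._+_ (sym (ℕ.*-identityʳ (f x))) (sum-filter≡sum-*𝟙 f xs)
    ... | false = trans (sum-filter≡sum-*𝟙 f xs) (cong (ℕ._+ rest) (sym (ℕ.*-zeroʳ (f x))))
      where
        rest : ℕ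
        rest = sumℕ (map (λ y → f y ℕ.* 𝟙 (does (P? y))) xs)

module _ {n : ℕ} (M : Matroid n) where

  tutteTerm : ℤ → ℤ → Subset n → ℤ
  tutteTerm x y S = (x - + 1) ^ (rk M ⊤ ∸ rk M S) ℤ.* (y - + 1) ^ (∣ S ∣ ∸ rk M S)

  isIndependent isSpanning : Subset n → Bool
  isIndependent S = does (rk M S ≟ ∣ S ∣)
  isSpanning    S = does (rk M S ≟ rk M ⊤)

  tutteTerm-2-1 : ∀ S → tutteTerm (+ 2) (+ 1) S ≡ + 𝟙 (isIndependent S)
  tutteTerm-2-1 S = trans (cong₂ ℤ._*_ (ℤ.^-zeroˡ (rk M ⊤ ∸ rk M S)) (0^[m∸n]≡𝟙[n≟m] (rk-bound M S)))
                          (ℤ.*-identityˡ _)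

  tutteTerm-1-2 : ∀ S → tutteTerm (+ 1) (+ 2) S ≡ + 𝟙 (isSpanning S)
  tutteTerm-1-2 S = trans (cong₂ ℤ._*_ (0^[m∸n]≡𝟙[n≟m] (rk-mono M S ⊤ (⊆-max S))) (ℤ.^-zeroˡ (∣ S ∣ ∸ rk M S)))
                          (ℤ.*-identityʳ _)

  -- The summand of T2 is local to its definition; abstracting it with refl makes it nameable.
  private
    T2-unfolded : ∀ x₁ x₂ y₁ y₂ → Σ (Subset n → Subset n → List ℤ) λ summand →
      T2 M x₁ x₂ y₁ y₂ ≡ sumℤ (concatMap (λ S₂ → concatMap (λ S₁ → summand S₁ S₂) (allSubsets n)) (allSubsets n))
    T2-unfolded x₁ x₂ y₁ y₂ = _ , refl

    T2-summand : ℤ → ℤ → ℤ → ℤ → Subset n → Subset n → List ℤ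
    T2-summand x₁ x₂ y₁ y₂ = proj₁ (T2-unfolded x₁ x₂ y₁ y₂)

    sum-T2-summand : ∀ x₁ x₂ y₁ y₂ S₁ S₂ → sumℤ (T2-summand x₁ x₂ y₁ y₂ S₁ S₂)
      ≡ + 𝟙 (does (S₁ ⊆? S₂)) ℤ.* tutteTerm x₁ y₁ S₁ ℤ.* tutteTerm x₂ y₂ S₂
    sum-T2-summand x₁ x₂ y₁ y₂ S₁ S₂ with does (S₁ ⊆? S₂)
    ... | false = refl
    ... | true  = trans (ℤ.+-identityʳ (tutteTerm x₁ y₁ S₁ ℤ.* tutteTerm x₂ y₂ S₂))
                        (cong (ℤ._* tutteTerm x₂ y₂ S₂) (sym (ℤ.*-identityˡ (tutteTerm x₁ y₁ S₁))))

  T2≡sum-⊆ : ∀ x₁ x₂ y₁ y₂ → T2 M x₁ x₂ y₁ y₂ ≡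
    sumℤ (map (λ S₂ → sumℤ (map (λ S₁ → + 𝟙 (does (S₁ ⊆? S₂)) ℤ.* tutteTerm x₁ y₁ S₁ ℤ.* tutteTerm x₂ y₂ S₂)
                                (allSubsets n)))
              (allSubsets n))
  T2≡sum-⊆ x₁ x₂ y₁ y₂ = begin
    T2 M x₁ x₂ y₁ y₂
      ≡⟨ proj₂ (T2-unfolded x₁ x₂ y₁ y₂) ⟩
    sumℤ (concatMap (λ S₂ → concatMap (λ S₁ → summand S₁ S₂) L) L)
      ≡⟨ sumℤ-concatMap _ L ⟩
    sumℤ (map (λ S₂ → sumℤ (concatMap (λ S₁ → summand S₁ S₂) L)) L)
      ≡⟨ cong sumℤ (map-cong (λ S₂ → trans (sumℤ-concatMap _ L)
                                           (cong sumℤ (map-cong (λ S₁ → sum-T2-summand x₁ x₂ y₁ y₂ S₁ S₂) L))) L) ⟩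
    _ ∎
    where
      open ≡-Reasoning
      L : List (Subset n)
      L = allSubsets n
      summand : Subset n → Subset n → List ℤ
      summand = T2-summand x₁ x₂ y₁ y₂

  NI≡sum-𝟙 : ∀ X → NI M X ≡ sumℕ (map (λ Y → 𝟙 (does (Y ⊆? X)) ℕ.* 𝟙 (isIndependent Y)) (allSubsets n))
  NI≡sum-𝟙 X = trans (length-filter≡sum-𝟙 _ (allSubsets n))
                     (cong sumℕ (map-cong (λ Y → 𝟙-∧ (does (Y ⊆? X)) (isIndependent Y)) (allSubsets n)))

  sum-independent-below : ∀ S₂ →
    sumℤ (map (λ S₁ → + 𝟙 (does (S₁ ⊆? S₂)) ℤ.* tutteTerm (+ 2) (+ 1) S₁ ℤ.* tutteTerm (+ 1) (+ 2) S₂)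
              (allSubsets n))
    ≡ + (NI M S₂ ℕ.* 𝟙 (isSpanning S₂))
  sum-independent-below S₂ = begin
    sumℤ (map (λ S₁ → + ⊆S₂ S₁ ℤ.* tutteTerm (+ 2) (+ 1) S₁ ℤ.* tutteTerm (+ 1) (+ 2) S₂) L)
      ≡⟨ cong sumℤ (map-cong evaluate L) ⟩
    sumℤ (map (λ S₁ → + (⊆S₂ S₁ ℕ.* 𝟙 (isIndependent S₁) ℕ.* 𝟙 (isSpanning S₂))) L)
      ≡⟨ sumℤ-map-+ _ L ⟩
    + sumℕ (map (λ S₁ → ⊆S₂ S₁ ℕ.* 𝟙 (isIndependent S₁) ℕ.* 𝟙 (isSpanning S₂)) L)
      ≡⟨ cong +_ (sum-map-*ʳ _ (𝟙 (isSpanning S₂)) L) ⟩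
    + (sumℕ (map (λ S₁ → ⊆S₂ S₁ ℕ.* 𝟙 (isIndependent S₁)) L) ℕ.* 𝟙 (isSpanning S₂))
      ≡⟨ cong (λ k → + (k ℕ.* 𝟙 (isSpanning S₂))) (sym (NI≡sum-𝟙 S₂)) ⟩
    + (NI M S₂ ℕ.* 𝟙 (isSpanning S₂)) ∎
    where
      open ≡-Reasoning
      L : List (Subset n)
      L = allSubsets n
      ⊆S₂ : Subset n → ℕ
      ⊆S₂ S₁ = 𝟙 (does (S₁ ⊆? S₂))
      evaluate : ∀ S₁ → + ⊆S₂ S₁ ℤ.* tutteTerm (+ 2) (+ 1) S₁ ℤ.* tutteTerm (+ 1) (+ 2) S₂
                      ≡ + (⊆S₂ S₁ ℕ.* 𝟙 (isIndependent S₁) ℕ.* 𝟙 (isSpanning S₂))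
      evaluate S₁ = begin
        + ⊆S₂ S₁ ℤ.* tutteTerm (+ 2) (+ 1) S₁ ℤ.* tutteTerm (+ 1) (+ 2) S₂
          ≡⟨ cong₂ (λ a b → + ⊆S₂ S₁ ℤ.* a ℤ.* b) (tutteTerm-2-1 S₁) (tutteTerm-1-2 S₂) ⟩
        + ⊆S₂ S₁ ℤ.* + 𝟙 (isIndependent S₁) ℤ.* + 𝟙 (isSpanning S₂)
          ≡⟨ cong (ℤ._* + 𝟙 (isSpanning S₂)) (sym (ℤ.pos-* (⊆S₂ S₁) (𝟙 (isIndependent S₁)))) ⟩
        + (⊆S₂ S₁ ℕ.* 𝟙 (isIndependent S₁)) ℤ.* + 𝟙 (isSpanning S₂)
          ≡⟨ sym (ℤ.pos-* (⊆S₂ S₁ ℕ.* 𝟙 (isIndependent S₁)) (𝟙 (isSpanning S₂))) ⟩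
        + (⊆S₂ S₁ ℕ.* 𝟙 (isIndependent S₁) ℕ.* 𝟙 (isSpanning S₂)) ∎

proposition5p6 : (n : ℕ) (M : Matroid n) →
    T2 M (+ 2) (+ 1) (+ 1) (+ 2) ≡ + (sumNISpanning M)
proposition5p6 n M = begin
  T2 M (+ 2) (+ 1) (+ 1) (+ 2)                             ≡⟨ T2≡sum-⊆ M (+ 2) (+ 1) (+ 1) (+ 2) ⟩
  sumℤ (map (λ S₂ → sumℤ (map (λ S₁ → + 𝟙 (does (S₁ ⊆? S₂)) ℤ.* tutteTerm M (+ 2) (+ 1) S₁
                                                            ℤ.* tutteTerm M (+ 1) (+ 2) S₂) L)) L)
                                                           ≡⟨ cong sumℤ (map-cong (sum-independent-below M) L) ⟩
  sumℤ (map (λ S₂ → + (NI M S₂ ℕ.* 𝟙 (isSpanning M S₂))) L) ≡⟨ sumℤ-map-+ _ L ⟩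
  + sumℕ (map (λ S₂ → NI M S₂ ℕ.* 𝟙 (isSpanning M S₂)) L)  ≡⟨ cong +_ (sym (sum-filter≡sum-*𝟙 _ (NI M) L)) ⟩
  + sumNISpanning M                                         ∎
  where
    open ≡-Reasoning
    L : List (Subset n)
    L = allSubsets n
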